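{- Let $G$ be a finite simple graph, let $u$ be a leaf of $G$ (a vertex of degree one) and let $v$ be the neighbor of $u$. Then $Z^-(G-\{u,v\})=Z^-(G)$.
   Context: Skew zero forcing: initially some set of vertices is colored blue and the rest white; the rule is: if $w$ is the only white neighbor of any vertex $u$ (blue or white), then $u$ may color $w$ blue. A skew zero forcing set is an initial blue set from which repeated application can make all vertices blue; $Z^-(G)$ is the minimum cardinality of a skew zero forcing set. $G-S$ denotes the subgraph induced by $V(G)\setminus S$, and by convention $Z^-$ of the graph with no vertices is $0$. -}

module Defs where

open import Data.Nat using (ℕ; _≤_)
open import Data.Bool using (Bool; true; false)
open import Data.Fin using (Fin)
open import Data.Fin.Subset using (Subset; _∈_; _∉_; _⊆_; _∪_; ⁅_⁆; ∣_∣)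
open import Data.Product using (Σ; _×_)
open import Relation.Binary.PropositionalEquality using (_≡_; _≢_)

record Graph (n : ℕ) : Set where
  field
    adj    : Fin n → Fin n → Bool
    sym    : ∀ x y → adj x y ≡ adj y x
    irrefl : ∀ x → adj x x ≡ false
open Graph public

module _ {n : ℕ} (G : Graph n) (W : Subset n) where
  -- All notions below are for the induced subgraph G[W].

  -- One application of the skew forcing rule: some vertex u of G[W]
  -- (blue or white) has w as its only white neighbour in G[W].
  SkewForce : Subset n → Fin n → Set
  SkewForce B w =
    Σ (Fin n) λ u → u ∈ W × w ∈ W × w ∉ B × adj G u w ≡ true ×
      (∀ x → x ∈ W → adj G u x ≡ true → x ≢ w → x ∈ B)

  data SkewReach : Subset n → Subset n → Set where
    done  : ∀ {B} → SkewReach B B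
    force : ∀ {B C} w → SkewForce B w → SkewReach (B ∪ ⁅ w ⁆) C → SkewReach B C

  IsSkewZFS : Subset n → Set
  IsSkewZFS B = B ⊆ W × Σ (Subset n) λ C → SkewReach B C × W ⊆ C

  IsZminus : ℕ → Set
  IsZminus k = (Σ (Subset n) λ B → IsSkewZFS B × ∣ B ∣ ≡ k)
             × (∀ B → IsSkewZFS B → k ≤ ∣ B ∣)

IsLeafWithNeighbour : ∀ {n} → Graph n → Fin n → Fin n → Set
IsLeafWithNeighbour G u v = adj G u v ≡ true × (∀ x → adj G u x ≡ true → x ≡ v)

module Submission where

-- Forcing is monotone, so a set B skew-forces G[W] iff the closure of B under the forcing rule
-- contains W; both inequalities are therefore proved with closed sets.
-- If B′ forces G − u − v, its closure F in G contains v (else u would force it), so F is also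
-- closed in G − u − v and contains every vertex but u, which v then forces.
-- Conversely, let F′ be the closure of B − {u, v} in G − u − v. The only possible force of G
-- from F′ ∪ {u, v} is by v. If there is none, B − {u, v} already forces G − u − v. If v forces
-- some w, then u ∈ B, since otherwise F′ ∪ {v} would be closed in G, contain B and miss u; so
-- (B − {u, v}) ∪ {w}, which forces G − u − v and is no larger than B, can be used instead.

open import Defs
open import Data.Bool using (true) renaming (_≟_ to _≟ᵇ_)
open import Data.Fin using (Fin) renaming (_≟_ to _≟ᶠ_)
open import Data.Fin.Properties using (any?; all?)
open import Data.Fin.Subset
  using (Subset; inside; outside; ⊤; _─_; _∪_; ⁅_⁆; _∈_; _∉_; _⊆_; _⊂_; _⊃_; ∣_∣)
open import Data.Fin.Subset.Properties
  using (_∈?_; _⊆?_; ∈⊤; ⊆⊤; x∈⁅x⁆; x∈⁅y⁆⇒x≡y; p⊆p∪q; q⊆p∪q; x∈p∪q⁻; ∪-identityʳ;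
         x∈p∧x∉q⇒x∈p─q; p─q⊆p; ∣p─q∣≤∣p∣; p⊂q⇒∣p∣<∣q∣; anySubset?)
open import Data.Fin.Subset.Induction using (⊃-wellFounded)
open import Data.Nat using (ℕ; suc; _≤_; _<_; _<?_; s≤s)
open import Data.Nat.Induction using (<-wellFounded)
open import Data.Nat.Properties using (≤-refl; ≤-trans; ≤-antisym; ≤-reflexive; n≤1+n; ≮⇒≥)
open import Data.Product using (Σ; _×_; _,_; proj₁; proj₂)
open import Data.Sum using (_⊎_; inj₁; inj₂; [_,_])
open import Data.Vec.Base using (_∷_; here; there)
open import Function using (_∘_; id)
open import Induction.WellFounded using (Acc; acc)
import Relation.Binary.Construct.On as On
open import Relation.Binary.PropositionalEquality using (_≡_; _≢_; refl; trans; ≢-sym)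
  renaming (sym to ≡-sym)
open import Relation.Nullary using (¬_; Dec; yes; no; contradiction)
open import Relation.Nullary.Decidable using (_×-dec_; _→-dec_; ¬?; decidable-stable)
open import Relation.Unary using (Decidable)

∪-⊆ : ∀ {n} {p q r : Subset n} → p ⊆ r → q ⊆ r → p ∪ q ⊆ r
∪-⊆ {p = p} {q} p⊆r q⊆r x∈p∪q = [ p⊆r , q⊆r ] (x∈p∪q⁻ p q x∈p∪q)

⁅x⁆⊆p : ∀ {n} {x : Fin n} {p} → x ∈ p → ⁅ x ⁆ ⊆ p
⁅x⁆⊆p {x = x} x∈p y∈⁅x⁆ with refl ← x∈⁅y⁆⇒x≡y x y∈⁅x⁆ = x∈p

x∈p─q⇒x∉q : ∀ {n} {x : Fin n} (p q : Subset n) → x ∈ p ─ q → x ∉ q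
x∈p─q⇒x∉q (inside ∷ p) (outside ∷ q) here ()
x∈p─q⇒x∉q (_ ∷ p) (_ ∷ q) (there x∈p─q) (there x∈q) = x∈p─q⇒x∉q p q x∈p─q x∈q

p⊂p∪⁅x⁆ : ∀ {n} {x : Fin n} {p} → x ∉ p → p ⊂ p ∪ ⁅ x ⁆
p⊂p∪⁅x⁆ {x = x} {p} x∉p = p⊆p∪q ⁅ x ⁆ , x , q⊆p∪q p ⁅ x ⁆ (x∈⁅x⁆ x) , x∉p

∣p∪⁅x⁆∣≤1+∣p∣ : ∀ {n} (p : Subset n) x → ∣ p ∪ ⁅ x ⁆ ∣ ≤ suc ∣ p ∣
∣p∪⁅x⁆∣≤1+∣p∣ (inside  ∷ p) Fin.zero    rewrite ∪-identityʳ p = n≤1+n _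
∣p∪⁅x⁆∣≤1+∣p∣ (outside ∷ p) Fin.zero    rewrite ∪-identityʳ p = ≤-refl
∣p∪⁅x⁆∣≤1+∣p∣ (inside  ∷ p) (Fin.suc x) = s≤s (∣p∪⁅x⁆∣≤1+∣p∣ p x)
∣p∪⁅x⁆∣≤1+∣p∣ (outside ∷ p) (Fin.suc x) = ∣p∪⁅x⁆∣≤1+∣p∣ p x

∣p─q∪⁅x⁆∣≤∣p∣ : ∀ {n} {y : Fin n} (p q : Subset n) x → y ∈ p → y ∈ q → ∣ (p ─ q) ∪ ⁅ x ⁆ ∣ ≤ ∣ p ∣
∣p─q∪⁅x⁆∣≤∣p∣ {y = y} p q x y∈p y∈q = ≤-trans (∣p∪⁅x⁆∣≤1+∣p∣ (p ─ q) x)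
  (p⊂q⇒∣p∣<∣q∣ (p─q⊆p p q , y , y∈p , λ y∈p─q → x∈p─q⇒x∉q p q y∈p─q y∈q))

minimal-∣∣ : ∀ {n} {P : Subset n → Set} → Decidable P → ∀ {B} → P B →
             Σ (Subset n) λ B₀ → P B₀ × (∀ C → P C → ∣ B₀ ∣ ≤ ∣ C ∣)
minimal-∣∣ {n} {P} P? {B} pB = go B (On.wellFounded ∣_∣ <-wellFounded B) pB
  where
  go : ∀ B → Acc (λ C D → ∣ C ∣ < ∣ D ∣) B → P B →
       Σ (Subset n) λ B₀ → P B₀ × (∀ C → P C → ∣ B₀ ∣ ≤ ∣ C ∣)
  go B (acc smaller) pB with anySubset? (λ C → P? C ×-dec ∣ C ∣ <? ∣ B ∣)
  ... | yes (C , pC , ∣C∣<∣B∣) = go C (smaller ∣C∣<∣B∣) pC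
  ... | no none = B , pB , λ C pC → ≮⇒≥ (λ ∣C∣<∣B∣ → none (C , pC , ∣C∣<∣B∣))

adj⇒≢ : ∀ {n} (G : Graph n) {x y} → adj G x y ≡ true → x ≢ y
adj⇒≢ G {x} x-adj-x refl = contradiction (trans (≡-sym (irrefl G x)) x-adj-x) λ ()

module SkewForcing {n} (G : Graph n) (W : Subset n) where

  SkewForce-white : ∀ {B w} → SkewForce G W B w → w ∉ B
  SkewForce-white (_ , _ , _ , w∉B , _) = w∉B

  SkewForce-mono : ∀ {B C w} → B ⊆ C → w ∉ C → SkewForce G W B w → SkewForce G W C w
  SkewForce-mono B⊆C w∉C (x , x∈W , w∈W , _ , x-adj-w , blue) =
    x , x∈W , w∈W , w∉C , x-adj-w , λ y y∈W x-adj-y y≢w → B⊆C (blue y y∈W x-adj-y y≢w)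

  SkewForce-restrict : ∀ {W′ B w} → W′ ⊆ W → (f : SkewForce G W B w) →
                       proj₁ f ∈ W′ → w ∈ W′ → SkewForce G W′ B w
  SkewForce-restrict W′⊆W (x , _ , _ , w∉B , x-adj-w , blue) x∈W′ w∈W′ =
    x , x∈W′ , w∈W′ , w∉B , x-adj-w , λ y y∈W′ → blue y (W′⊆W y∈W′)

  SkewForce? : ∀ B w → Dec (SkewForce G W B w)
  SkewForce? B w = any? λ x →
    x ∈? W ×-dec w ∈? W ×-dec ¬? (w ∈? B) ×-dec adj G x w ≟ᵇ true ×-dec
    all? λ y → y ∈? W →-dec adj G x y ≟ᵇ true →-dec ¬? (y ≟ᶠ w) →-dec y ∈? B

  SkewReach-⊆ : ∀ {B C} → SkewReach G W B C → B ⊆ C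
  SkewReach-⊆ done = id
  SkewReach-⊆ (force w _ B∪w→C) = SkewReach-⊆ B∪w→C ∘ p⊆p∪q ⁅ w ⁆

  SkewReach-⊆W : ∀ {B C} → B ⊆ W → SkewReach G W B C → C ⊆ W
  SkewReach-⊆W B⊆W done = B⊆W
  SkewReach-⊆W B⊆W (force w (_ , _ , w∈W , _) B∪w→C) = SkewReach-⊆W (∪-⊆ B⊆W (⁅x⁆⊆p w∈W)) B∪w→C

  Closed : Subset n → Set
  Closed F = ∀ w → ¬ SkewForce G W F w

  Closed⇒∈ : ∀ {F w} → Closed F → (w ∉ F → SkewForce G W F w) → w ∈ F
  Closed⇒∈ {F} {w} closed forcing = decidable-stable (w ∈? F) λ w∉F → closed w (forcing w∉F)

  Closed-∪ : ∀ {F R} → (∀ {x} → x ∈ R → x ∉ W) → Closed F → Closed (F ∪ R)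
  Closed-∪ {F} {R} R∩W≡∅ closed w (x , x∈W , w∈W , w∉F∪R , x-adj-w , blue) =
    closed w (x , x∈W , w∈W , w∉F∪R ∘ p⊆p∪q R , x-adj-w , λ y y∈W x-adj-y y≢w →
      [ id , (λ y∈R → contradiction y∈W (R∩W≡∅ y∈R)) ] (x∈p∪q⁻ F R (blue y y∈W x-adj-y y≢w)))

  SkewReach-⊆-Closed : ∀ {B C F} → Closed F → B ⊆ F → SkewReach G W B C → C ⊆ F
  SkewReach-⊆-Closed closed B⊆F done = B⊆F
  SkewReach-⊆-Closed closed B⊆F (force w f B∪w→C) = SkewReach-⊆-Closed closed
    (∪-⊆ B⊆F (⁅x⁆⊆p (Closed⇒∈ closed λ w∉F → SkewForce-mono B⊆F w∉F f))) B∪w→C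

  closure : ∀ B → Σ (Subset n) λ F → SkewReach G W B F × Closed F
  closure B = go B (⊃-wellFounded B)
    where
    go : ∀ B → Acc _⊃_ B → Σ (Subset n) λ F → SkewReach G W B F × Closed F
    go B (acc larger) with any? (SkewForce? B)
    ... | no none = B , done , λ w f → none (w , f)
    ... | yes (w , f) with go (B ∪ ⁅ w ⁆) (larger (p⊂p∪⁅x⁆ (SkewForce-white f)))
    ...   | F , B∪w→F , closed = F , force w f B∪w→F , closed

  IsSkewZFS⇒⊆Closed : ∀ {B F} → IsSkewZFS G W B → B ⊆ F → Closed F → W ⊆ F
  IsSkewZFS⇒⊆Closed (_ , C , B→C , W⊆C) B⊆F closed = SkewReach-⊆-Closed closed B⊆F B→C ∘ W⊆C

  IsSkewZFS? : Decidable (IsSkewZFS G W)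
  IsSkewZFS? B with B ⊆? W | closure B
  ... | no B⊈W | _ = no (B⊈W ∘ proj₁)
  ... | yes B⊆W | F , B→F , closed with W ⊆? F
  ...   | yes W⊆F = yes (B⊆W , F , B→F , W⊆F)
  ...   | no W⊈F = no λ zfs → W⊈F (IsSkewZFS⇒⊆Closed zfs (SkewReach-⊆ B→F) closed)

  Zminus-exists : Σ ℕ (IsZminus G W)
  Zminus-exists with minimal-∣∣ IsSkewZFS? {W} (id , W , done , id)
  ... | B , zfs , minimal = ∣ B ∣ , (B , zfs , refl) , minimal

IsZminus-transfer : ∀ {n} {G : Graph n} {W W′ k} →
  (∀ {B} → IsSkewZFS G W′ B → IsSkewZFS G W B) →
  (∀ {B} → IsSkewZFS G W B → Σ (Subset n) λ B′ → IsSkewZFS G W′ B′ × ∣ B′ ∣ ≤ ∣ B ∣) →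
  IsZminus G W k → IsZminus G W′ k
IsZminus-transfer lift shrink ((B , zfs , ∣B∣≡k) , minimal) with shrink zfs
... | B′ , zfs′ , ∣B′∣≤∣B∣ =
  (B′ , zfs′ , ≤-antisym (≤-trans ∣B′∣≤∣B∣ (≤-reflexive ∣B∣≡k)) (minimal B′ (lift zfs′))) ,
  λ C zfsC → minimal C (lift zfsC)

module LeafDeletion {n} (G : Graph n) (u v : Fin n) (leaf : IsLeafWithNeighbour G u v) where

  uv : Subset n
  uv = ⁅ u ⁆ ∪ ⁅ v ⁆

  V∖uv : Subset n
  V∖uv = ⊤ ─ uv

  module G  = SkewForcing G ⊤
  module G′ = SkewForcing G V∖uv

  u-adj-v : adj G u v ≡ true
  u-adj-v = proj₁ leaf

  u-adj⇒≡v : ∀ {x} → adj G u x ≡ true → x ≡ v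
  u-adj⇒≡v = proj₂ leaf _

  v-adj-u : adj G v u ≡ true
  v-adj-u = trans (Graph.sym G v u) u-adj-v

  adj-u⇒≡v : ∀ {x} → adj G x u ≡ true → x ≡ v
  adj-u⇒≡v {x} x-adj-u = u-adj⇒≡v (trans (Graph.sym G u x) x-adj-u)

  u∈uv : u ∈ uv
  u∈uv = p⊆p∪q ⁅ v ⁆ (x∈⁅x⁆ u)

  v∈uv : v ∈ uv
  v∈uv = q⊆p∪q ⁅ u ⁆ ⁅ v ⁆ (x∈⁅x⁆ v)

  ∈V∖uv⇒∉uv : ∀ {x} → x ∈ V∖uv → x ∉ uv
  ∈V∖uv⇒∉uv = x∈p─q⇒x∉q ⊤ uv

  ∈uv⇒∉V∖uv : ∀ {x} → x ∈ uv → x ∉ V∖uv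
  ∈uv⇒∉V∖uv x∈uv x∈V∖uv = ∈V∖uv⇒∉uv x∈V∖uv x∈uv

  ∈V∖uv⇒≢u : ∀ {x} → x ∈ V∖uv → x ≢ u
  ∈V∖uv⇒≢u x∈V∖uv refl = ∈V∖uv⇒∉uv x∈V∖uv u∈uv

  ∈V∖uv⇒≢v : ∀ {x} → x ∈ V∖uv → x ≢ v
  ∈V∖uv⇒≢v x∈V∖uv refl = ∈V∖uv⇒∉uv x∈V∖uv v∈uv

  ∉uv⇒∈V∖uv : ∀ {x} → x ∉ uv → x ∈ V∖uv
  ∉uv⇒∈V∖uv = x∈p∧x∉q⇒x∈p─q ∈⊤

  ∈V∖uv⁺ : ∀ {x} → x ≢ u → x ≢ v → x ∈ V∖uv
  ∈V∖uv⁺ x≢u x≢v = ∉uv⇒∈V∖uv ([ x≢u ∘ x∈⁅y⁆⇒x≡y u , x≢v ∘ x∈⁅y⁆⇒x≡y v ] ∘ x∈p∪q⁻ ⁅ u ⁆ ⁅ v ⁆)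

  vertex-cases : ∀ x → x ∈ V∖uv ⊎ x ≡ u ⊎ x ≡ v
  vertex-cases x with x ≟ᶠ u | x ≟ᶠ v
  ... | yes x≡u | _ = inj₂ (inj₁ x≡u)
  ... | no _ | yes x≡v = inj₂ (inj₂ x≡v)
  ... | no x≢u | no x≢v = inj₁ (∈V∖uv⁺ x≢u x≢v)

  ∈F∪uv⇒∈F : ∀ {F x} → x ∈ V∖uv → x ∈ F ∪ uv → x ∈ F
  ∈F∪uv⇒∈F {F} x∈V∖uv x∈F∪uv =
    [ id , (λ x∈uv → contradiction x∈V∖uv (∈uv⇒∉V∖uv x∈uv)) ] (x∈p∪q⁻ F uv x∈F∪uv)

  B─uv⊆V∖uv : ∀ B → B ─ uv ⊆ V∖uv
  B─uv⊆V∖uv B = ∉uv⇒∈V∖uv ∘ x∈p─q⇒x∉q B uv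

  B⊆B─uv∪uv : ∀ B → B ⊆ (B ─ uv) ∪ uv
  B⊆B─uv∪uv B {x} x∈B with x ∈? uv
  ... | yes x∈uv = q⊆p∪q (B ─ uv) uv x∈uv
  ... | no x∉uv = p⊆p∪q uv (x∈p∧x∉q⇒x∈p─q x∈B x∉uv)

  u-forces-v : ∀ {F} → v ∉ F → SkewForce G ⊤ F v
  u-forces-v v∉F =
    u , ∈⊤ , ∈⊤ , v∉F , u-adj-v , λ x _ u-adj-x x≢v → contradiction (u-adj⇒≡v u-adj-x) x≢v

  v-forces-u : ∀ {F} → V∖uv ⊆ F → u ∉ F → SkewForce G ⊤ F u
  v-forces-u V∖uv⊆F u∉F = v , ∈⊤ , ∈⊤ , u∉F , v-adj-u , λ x _ v-adj-x x≢u →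
    V∖uv⊆F (∈V∖uv⁺ x≢u (≢-sym (adj⇒≢ G v-adj-x)))

  Closed-∋v⇒Closed′ : ∀ {F} → v ∈ F → G.Closed F → G′.Closed F
  Closed-∋v⇒Closed′ {F} v∈F closed w (x , x∈V∖uv , _ , w∉F , x-adj-w , blue) =
    closed w (x , ∈⊤ , ∈⊤ , w∉F , x-adj-w , blue′)
    where
    blue′ : ∀ y → y ∈ ⊤ → adj G x y ≡ true → y ≢ w → y ∈ F
    blue′ y _ x-adj-y y≢w with vertex-cases y
    ... | inj₁ y∈V∖uv = blue y y∈V∖uv x-adj-y y≢w
    ... | inj₂ (inj₁ refl) = contradiction (adj-u⇒≡v x-adj-y) (∈V∖uv⇒≢v x∈V∖uv)
    ... | inj₂ (inj₂ refl) = v∈F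

  IsSkewZFS′⇒IsSkewZFS : ∀ {B} → IsSkewZFS G V∖uv B → IsSkewZFS G ⊤ B
  IsSkewZFS′⇒IsSkewZFS {B} zfs′ with G.closure B
  ... | F , B→F , closed = ⊆⊤ , F , B→F , λ {x} _ → ∈F x
    where
    v∈F : v ∈ F
    v∈F = G.Closed⇒∈ closed u-forces-v
    V∖uv⊆F : V∖uv ⊆ F
    V∖uv⊆F = G′.IsSkewZFS⇒⊆Closed zfs′ (G.SkewReach-⊆ B→F) (Closed-∋v⇒Closed′ v∈F closed)
    ∈F : ∀ x → x ∈ F
    ∈F x with vertex-cases x
    ... | inj₁ x∈V∖uv = V∖uv⊆F x∈V∖uv
    ... | inj₂ (inj₁ refl) = G.Closed⇒∈ closed (v-forces-u V∖uv⊆F)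
    ... | inj₂ (inj₂ refl) = v∈F

  u∉F′∪v : ∀ {F′} → F′ ⊆ V∖uv → u ∉ F′ ∪ ⁅ v ⁆
  u∉F′∪v {F′} F′⊆V∖uv u∈F′∪v =
    [ (λ u∈F′ → ∈V∖uv⇒∉uv (F′⊆V∖uv u∈F′) u∈uv) , adj⇒≢ G u-adj-v ∘ x∈⁅y⁆⇒x≡y v ]
      (x∈p∪q⁻ F′ ⁅ v ⁆ u∈F′∪v)

  ForcedByV : Subset n → Fin n → Set
  ForcedByV F w = adj G v w ≡ true × (∀ y → adj G v y ≡ true → y ≢ w → y ∈ F)

  Closed′⇒forced-by-v : ∀ {F′ w} → G′.Closed F′ → SkewForce G ⊤ (F′ ∪ uv) w →
                        w ∈ V∖uv × ForcedByV (F′ ∪ uv) w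
  Closed′⇒forced-by-v {F′} {w} closed′ f@(x , _ , _ , w∉F′∪uv , x-adj-w , blue) with vertex-cases w
  ... | inj₂ (inj₁ refl) = contradiction (q⊆p∪q F′ uv u∈uv) w∉F′∪uv
  ... | inj₂ (inj₂ refl) = contradiction (q⊆p∪q F′ uv v∈uv) w∉F′∪uv
  ... | inj₁ w∈V∖uv with vertex-cases x
  ...   | inj₁ x∈V∖uv =
    contradiction (G.SkewForce-restrict ⊆⊤ f x∈V∖uv w∈V∖uv) (G′.Closed-∪ ∈uv⇒∉V∖uv closed′ w)
  ...   | inj₂ (inj₁ refl) = contradiction (u-adj⇒≡v x-adj-w) (∈V∖uv⇒≢v w∈V∖uv)
  ...   | inj₂ (inj₂ refl) = w∈V∖uv , x-adj-w , λ y → blue y ∈⊤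

  Closed′⇒Closed : ∀ {F′} → G′.Closed F′ → (∀ y → adj G v y ≡ true → y ∈ F′ ∪ uv) →
                   G.Closed (F′ ∪ uv)
  Closed′⇒Closed closed′ N[v]⊆F′∪uv w f =
    G.SkewForce-white f (N[v]⊆F′∪uv w (proj₁ (proj₂ (Closed′⇒forced-by-v closed′ f))))

  Closed′⇒Closed-∪v : ∀ {F′ w} → F′ ⊆ V∖uv → G′.Closed F′ → w ∈ V∖uv → w ∉ F′ →
                      adj G v w ≡ true → G.Closed (F′ ∪ ⁅ v ⁆)
  Closed′⇒Closed-∪v {F′} {w} F′⊆V∖uv closed′ w∈V∖uv w∉F′ v-adj-w
                    w₂ f@(x , _ , _ , w₂∉ , x-adj-w₂ , blue) with vertex-cases w₂
  ... | inj₂ (inj₂ refl) = w₂∉ (q⊆p∪q F′ ⁅ v ⁆ (x∈⁅x⁆ v))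
  ... | inj₂ (inj₁ refl) with refl ← adj-u⇒≡v x-adj-w₂ =
    [ w∉F′ , ∈V∖uv⇒≢v w∈V∖uv ∘ x∈⁅y⁆⇒x≡y v ]
      (x∈p∪q⁻ F′ ⁅ v ⁆ (blue w ∈⊤ v-adj-w (∈V∖uv⇒≢u w∈V∖uv)))
  ... | inj₁ w₂∈V∖uv with vertex-cases x
  ...   | inj₁ x∈V∖uv = G′.Closed-∪ (∈uv⇒∉V∖uv ∘ q⊆p∪q ⁅ u ⁆ ⁅ v ⁆) closed′ w₂
      (G.SkewForce-restrict ⊆⊤ f x∈V∖uv w₂∈V∖uv)
  ...   | inj₂ (inj₁ refl) = ∈V∖uv⇒≢v w₂∈V∖uv (u-adj⇒≡v x-adj-w₂)
  ...   | inj₂ (inj₂ refl) = u∉F′∪v F′⊆V∖uv (blue u ∈⊤ v-adj-u (≢-sym (∈V∖uv⇒≢u w₂∈V∖uv)))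

  IsSkewZFS′-from-Closed : ∀ {B B′ F′} → IsSkewZFS G ⊤ B → B ─ uv ⊆ B′ → B′ ⊆ V∖uv →
                           SkewReach G V∖uv B′ F′ → G.Closed (F′ ∪ uv) → IsSkewZFS G V∖uv B′
  IsSkewZFS′-from-Closed {B} {F′ = F′} zfs B─uv⊆B′ B′⊆V∖uv B′→F′ closed =
    B′⊆V∖uv , F′ , B′→F′ , λ x∈V∖uv → ∈F∪uv⇒∈F x∈V∖uv (⊤⊆F′∪uv ∈⊤)
    where
    B⊆F′∪uv : B ⊆ F′ ∪ uv
    B⊆F′∪uv = ∪-⊆ (p⊆p∪q uv ∘ G′.SkewReach-⊆ B′→F′ ∘ B─uv⊆B′) (q⊆p∪q F′ uv) ∘ B⊆B─uv∪uv B
    ⊤⊆F′∪uv : ⊤ ⊆ F′ ∪ uv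
    ⊤⊆F′∪uv = G.IsSkewZFS⇒⊆Closed zfs B⊆F′∪uv closed

  forced-by-v⇒u∈B : ∀ {B F′ w} → IsSkewZFS G ⊤ B → SkewReach G V∖uv (B ─ uv) F′ → G′.Closed F′ →
                    w ∈ V∖uv → w ∉ F′ → adj G v w ≡ true → u ∈ B
  forced-by-v⇒u∈B {B} {F′} zfs B─uv→F′ closed′ w∈V∖uv w∉F′ v-adj-w =
    decidable-stable (u ∈? B) λ u∉B → u∉F′∪v F′⊆V∖uv (⊤⊆F′∪v u∉B ∈⊤)
    where
    F′⊆V∖uv : F′ ⊆ V∖uv
    F′⊆V∖uv = G′.SkewReach-⊆W (B─uv⊆V∖uv B) B─uv→F′
    B⊆F′∪v : u ∉ B → B ⊆ F′ ∪ ⁅ v ⁆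
    B⊆F′∪v u∉B {x} x∈B with vertex-cases x
    ... | inj₁ x∈V∖uv =
      p⊆p∪q ⁅ v ⁆ (G′.SkewReach-⊆ B─uv→F′ (x∈p∧x∉q⇒x∈p─q x∈B (∈V∖uv⇒∉uv x∈V∖uv)))
    ... | inj₂ (inj₁ refl) = contradiction x∈B u∉B
    ... | inj₂ (inj₂ refl) = q⊆p∪q F′ ⁅ v ⁆ (x∈⁅x⁆ v)
    ⊤⊆F′∪v : u ∉ B → ⊤ ⊆ F′ ∪ ⁅ v ⁆
    ⊤⊆F′∪v u∉B = G.IsSkewZFS⇒⊆Closed zfs (B⊆F′∪v u∉B)
      (Closed′⇒Closed-∪v F′⊆V∖uv closed′ w∈V∖uv w∉F′ v-adj-w)

  IsSkewZFS⇒IsSkewZFS′ : ∀ {B} → IsSkewZFS G ⊤ B →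
                         Σ (Subset n) λ B′ → IsSkewZFS G V∖uv B′ × ∣ B′ ∣ ≤ ∣ B ∣
  IsSkewZFS⇒IsSkewZFS′ {B} zfs with G′.closure (B ─ uv)
  ... | F′ , B─uv→F′ , closed′ with any? (G.SkewForce? (F′ ∪ uv))
  ...   | no none = B ─ uv ,
    IsSkewZFS′-from-Closed zfs id (B─uv⊆V∖uv B) B─uv→F′ (λ w f → none (w , f)) , ∣p─q∣≤∣p∣ B uv
  ...   | yes (w , f) with Closed′⇒forced-by-v closed′ f
  ...     | w∈V∖uv , v-adj-w , N[v]∖w⊆F′∪uv with G′.closure ((B ─ uv) ∪ ⁅ w ⁆)
  ...       | F″ , B″→F″ , closed″ = (B ─ uv) ∪ ⁅ w ⁆ ,
    IsSkewZFS′-from-Closed zfs (p⊆p∪q ⁅ w ⁆) (∪-⊆ (B─uv⊆V∖uv B) (⁅x⁆⊆p w∈V∖uv)) B″→F″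
      (Closed′⇒Closed closed″ N[v]⊆F″∪uv) ,
    ∣p─q∪⁅x⁆∣≤∣p∣ B uv w u∈B u∈uv
    where
    u∈B : u ∈ B
    u∈B = forced-by-v⇒u∈B zfs B─uv→F′ closed′ w∈V∖uv (G.SkewForce-white f ∘ p⊆p∪q uv) v-adj-w
    F′⊆F″ : F′ ⊆ F″
    F′⊆F″ = G′.SkewReach-⊆-Closed closed″ (G′.SkewReach-⊆ B″→F″ ∘ p⊆p∪q ⁅ w ⁆) B─uv→F′
    N[v]⊆F″∪uv : ∀ y → adj G v y ≡ true → y ∈ F″ ∪ uv
    N[v]⊆F″∪uv y v-adj-y with y ≟ᶠ w
    ... | yes refl = p⊆p∪q uv (G′.SkewReach-⊆ B″→F″ (q⊆p∪q (B ─ uv) ⁅ w ⁆ (x∈⁅x⁆ w)))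
    ... | no y≢w = [ p⊆p∪q uv ∘ F′⊆F″ , q⊆p∪q F″ uv ] (x∈p∪q⁻ F′ uv (N[v]∖w⊆F′∪uv y v-adj-y y≢w))

theorem3p20 : ∀ {n} (G : Graph n) (u v : Fin n) → IsLeafWithNeighbour G u v →
    Σ ℕ λ k → IsZminus G ⊤ k × IsZminus G (⊤ ─ (⁅ u ⁆ ∪ ⁅ v ⁆)) k
theorem3p20 G u v leaf with SkewForcing.Zminus-exists G ⊤
... | k , Z⁻[G]≡k =
  k , Z⁻[G]≡k , IsZminus-transfer IsSkewZFS′⇒IsSkewZFS IsSkewZFS⇒IsSkewZFS′ Z⁻[G]≡k
  where open LeafDeletion G u v leaf
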